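{- Let $p$ be an odd prime and $q=p^r$. Then for all integers $0\le a\le q-2$ and $0\le i\le r-1$, \[ -\left\lfloor\frac{ -4ap^i}{q-1}\right\rfloor+\left\lfloor\frac{ -2ap^i}{q-1}\right\rfloor=-\left\lfloor\left\langle\frac{p^i}{4}\right\rangle-\frac{ap^i}{q-1}\right\rfloor-\left\lfloor\left\langle\frac{3p^i}{4}\right\rangle-\frac{ap^i}{q-1}\right\rfloor. \]
   Context: $\lfloor y\rfloor$ is the greatest integer $\le y$ and $\langle y\rangle=y-\lfloor y\rfloor$ is the fractional part. -}

module Defs where

open import Data.Integer using (ℤ)
open import Data.Rational using (ℚ; floor; _-_; _/_)

frac : ℚ → ℚ
frac y = y - (floor y / 1)

module Submission where

-- Write N = q - 1, M = a·pⁱ, P = pⁱ and x = M/N.  The identity only uses that P is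
-- odd, so that {⟨P/4⟩, ⟨3P/4⟩} = {1/4, 3/4}; it is then an instance of Hermite's
-- identity ⌊y⌋ + ⌊y + 1/2⌋ = ⌊2y⌋, applied twice:
--   ⌊-4x⌋ = ⌊-2x⌋ + ⌊-2x + 1/2⌋        and        ⌊-2x + 1/2⌋ = ⌊1/4 - x⌋ + ⌊3/4 - x⌋,
-- so both sides equal -⌊1/2 - 2x⌋.

module FloorDivision where

  open import Data.Nat as ℕ using (ℕ)
  import Data.Nat.Properties as ℕ
  open import Data.Integer
  open import Data.Integer.Properties
  open import Data.Integer.DivMod using (_/ℕ_; _%ℕ_; n%ℕd<d; a≡a%ℕn+[a/ℕn]*n; [n/ℕd]*d≤n; n<s[n/ℕd]*d)
  open import Data.Integer.Tactic.RingSolver using (solve-∀)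
  open import Relation.Binary.PropositionalEquality
  open import Relation.Nullary using (yes; no)
  open import Algebra.Properties.CommutativeSemigroup *-commutativeSemigroup using (xy∙z≈xz∙y)

  quotient-≤ : ∀ {z q k} d → q * + d ≤ z → z < suc k * + d → q ≤ k
  quotient-≤ {z} {q} {k} d qd≤z z<[k+1]d =
    subst (q ≤_) (pred-suc k)
      (i<j⇒i≤pred[j] {q} {suc k} (*-cancelʳ-<-nonNeg (+ d) (≤-<-trans qd≤z z<[k+1]d)))

  /ℕ-unique : ∀ {z k} s d .{{_ : ℕ.NonZero d}} → z ≡ + s + k * + d → s ℕ.< d → z /ℕ d ≡ k
  /ℕ-unique {z} {k} s d z≡ s<d =
    ≤-antisym (quotient-≤ d ([n/ℕd]*d≤n z d) z<[k+1]d) (quotient-≤ d kd≤z (n<s[n/ℕd]*d z d))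
    where
    kd≤z : k * + d ≤ z
    kd≤z = subst (k * + d ≤_) (sym z≡) (i≤j+i (k * + d) (+ s))
    z<[k+1]d : z < suc k * + d
    z<[k+1]d = begin-strict
      z              ≡⟨ z≡ ⟩
      + s + k * + d  <⟨ +-monoˡ-< (k * + d) (+<+ s<d) ⟩
      + d + k * + d  ≡⟨ suc-* k (+ d) ⟨
      suc k * + d    ∎
      where open ≤-Reasoning

  /ℕ-cross : ∀ z w d e .{{_ : ℕ.NonZero d}} .{{_ : ℕ.NonZero e}} →
             z * + e ≡ w * + d → z /ℕ d ≡ w /ℕ e
  /ℕ-cross z w d e ze≡wd = ≤-antisym (cross-≤ z w d e ze≡wd) (cross-≤ w z e d (sym ze≡wd))
    where
    cross-≤ : ∀ z w d e .{{_ : ℕ.NonZero d}} .{{_ : ℕ.NonZero e}} →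
              z * + e ≡ w * + d → z /ℕ d ≤ w /ℕ e
    cross-≤ z w d e ze≡wd = quotient-≤ e qe≤w (n<s[n/ℕd]*d w e)
      where
      q = z /ℕ d
      qe≤w : q * + e ≤ w
      qe≤w = *-cancelʳ-≤-pos (q * + e) w (+ d) {{positive (+<+ (ℕ.>-nonZero⁻¹ d))}} (begin
        q * + e * + d  ≡⟨ xy∙z≈xz∙y q (+ e) (+ d) ⟩
        q * + d * + e  ≤⟨ *-monoʳ-≤-nonNeg (+ e) ([n/ℕd]*d≤n z d) ⟩
        z * + e        ≡⟨ ze≡wd ⟩
        w * + d        ∎)
        where open ≤-Reasoning

  /ℕ-cancelˡ-* : ∀ z m d .{{_ : ℕ.NonZero d}} .{{_ : ℕ.NonZero (m ℕ.* d)}} →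
                 (+ m * z) /ℕ (m ℕ.* d) ≡ z /ℕ d
  /ℕ-cancelˡ-* z m d = /ℕ-cross (+ m * z) z (m ℕ.* d) d (begin
    + m * z * + d    ≡⟨ ring (+ m) z (+ d) ⟩
    z * (+ m * + d)  ≡⟨ cong (z *_) (pos-* m d) ⟨
    z * + (m ℕ.* d)  ∎)
    where
    open ≡-Reasoning
    ring : ∀ m z d → m * z * d ≡ z * (m * d)
    ring = solve-∀

  -- Hermite's identity ⌊y⌋ = ⌊y/2⌋ + ⌊y/2 + 1/2⌋ at y = z/d.  Writing z = r + q·2d with
  -- 0 ≤ r < 2d, both sides equal q + q if r < d, and q + (q + 1) if r = d + t.
  hermite : ∀ z d .{{_ : ℕ.NonZero d}} .{{_ : ℕ.NonZero (2 ℕ.* d)}} →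
            z /ℕ d ≡ z /ℕ (2 ℕ.* d) + (z + + d) /ℕ (2 ℕ.* d)
  hermite z d = split (z %ℕ 2d) (z /ℕ 2d) z=r+q·2d (n%ℕd<d z 2d)
    where
    2d = 2 ℕ.* d

    2d≡ : + 2d ≡ + 2 * + d
    2d≡ = pos-* 2 d

    d+d≡2d : d ℕ.+ d ≡ 2d
    d+d≡2d = cong (d ℕ.+_) (sym (ℕ.+-identityʳ d))

    z=r+q·2d : z ≡ + (z %ℕ 2d) + z /ℕ 2d * (+ 2 * + d)
    z=r+q·2d = trans (a≡a%ℕn+[a/ℕn]*n z 2d) (cong (λ e → + (z %ℕ 2d) + z /ℕ 2d * e) 2d≡)

    split : ∀ r q → z ≡ + r + q * (+ 2 * + d) → r ℕ.< 2d → z /ℕ d ≡ q + (z + + d) /ℕ 2d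
    split r q zq r<2d with r ℕ.<? d
    ... | yes r<d =
      trans (/ℕ-unique r d z=r+2q·d r<d) (cong (_+_ q) (sym (/ℕ-unique (r ℕ.+ d) 2d z+d=r+d+q·2d r+d<2d)))
      where
      z=r+2q·d : z ≡ + r + (q + q) * + d
      z=r+2q·d = trans zq (ring (+ r) q (+ d))
        where
        ring : ∀ r q d → r + q * (+ 2 * d) ≡ r + (q + q) * d
        ring = solve-∀
      z+d=r+d+q·2d : z + + d ≡ + (r ℕ.+ d) + q * + 2d
      z+d=r+d+q·2d = begin
        z + + d                        ≡⟨ cong (_+ + d) zq ⟩
        + r + q * (+ 2 * + d) + + d    ≡⟨ ring (+ r) q (+ d) ⟩
        (+ r + + d) + q * (+ 2 * + d)  ≡⟨ cong₂ (λ x y → x + q * y) (pos-+ r d) 2d≡ ⟨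
        + (r ℕ.+ d) + q * + 2d         ∎
        where
        open ≡-Reasoning
        ring : ∀ r q d → r + q * (+ 2 * d) + d ≡ (r + d) + q * (+ 2 * d)
        ring = solve-∀
      r+d<2d : r ℕ.+ d ℕ.< 2d
      r+d<2d = subst (r ℕ.+ d ℕ.<_) d+d≡2d (ℕ.+-monoˡ-< d r<d)
    ... | no r≮d =
      trans (/ℕ-unique t d z=t+[2q+1]·d t<d)
        (cong (_+_ q) (sym (/ℕ-unique t 2d z+d=t+[q+1]·2d (ℕ.<-≤-trans t<d (ℕ.m≤n*m d 2)))))
      where
      t = r ℕ.∸ d
      d+t≡r : d ℕ.+ t ≡ r
      d+t≡r = ℕ.m+[n∸m]≡n (ℕ.≮⇒≥ r≮d)
      r≡d+t : + r ≡ + d + + t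
      r≡d+t = trans (cong +_ (sym d+t≡r)) (pos-+ d t)
      z=t+[2q+1]·d : z ≡ + t + (q + (q + 1ℤ)) * + d
      z=t+[2q+1]·d = trans zq (trans (cong (λ x → x + q * (+ 2 * + d)) r≡d+t) (ring (+ t) q (+ d)))
        where
        ring : ∀ t q d → d + t + q * (+ 2 * d) ≡ t + (q + (q + 1ℤ)) * d
        ring = solve-∀
      z+d=t+[q+1]·2d : z + + d ≡ + t + (q + 1ℤ) * + 2d
      z+d=t+[q+1]·2d = begin
        z + + d                            ≡⟨ cong (_+ + d) zq ⟩
        + r + q * (+ 2 * + d) + + d        ≡⟨ cong (λ x → x + q * (+ 2 * + d) + + d) r≡d+t ⟩
        + d + + t + q * (+ 2 * + d) + + d  ≡⟨ ring (+ t) q (+ d) ⟩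
        + t + (q + 1ℤ) * (+ 2 * + d)       ≡⟨ cong (λ x → + t + (q + 1ℤ) * x) 2d≡ ⟨
        + t + (q + 1ℤ) * + 2d              ∎
        where
        open ≡-Reasoning
        ring : ∀ t q d → d + t + q * (+ 2 * d) + d ≡ t + (q + 1ℤ) * (+ 2 * d)
        ring = solve-∀
      t<d : t ℕ.< d
      t<d = ℕ.+-cancelˡ-< d t d (subst₂ ℕ._<_ (sym d+t≡r) (sym d+d≡2d) r<2d)

  -- The theorem in integer form, for x = M/N:  -⌊-4x⌋ + ⌊-2x⌋ = -⌊1/4 - x⌋ - ⌊3/4 - x⌋.
  -- Hermite at -4x and the cancellation ⌊-4x/2⌋ = ⌊-2x⌋ reduce the left side to
  -- -⌊-2x + 1/2⌋; Hermite at -2x + 1/2 splits this into the two terms on the right.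
  quarter-identity : ∀ M N .{{_ : ℕ.NonZero N}} .{{_ : ℕ.NonZero (2 ℕ.* N)}}
                     .{{_ : ℕ.NonZero (2 ℕ.* (2 ℕ.* N))}} →
    - ((- (+ 4 * M)) /ℕ N) + (- (+ 2 * M)) /ℕ N ≡
    - ((+ 1 * + N - M * + 4) /ℕ (2 ℕ.* (2 ℕ.* N))) - (+ 3 * + N - M * + 4) /ℕ (2 ℕ.* (2 ℕ.* N))
  quarter-identity M N = begin
    - (-4M /ℕ N) + -2M /ℕ N
      ≡⟨ cong₂ (λ x y → - x + y) (hermite -4M N) (sym halve) ⟩
    - (-4M /ℕ 2N + (-4M + + N) /ℕ 2N) + -4M /ℕ 2N
      ≡⟨ cancel (-4M /ℕ 2N) ((-4M + + N) /ℕ 2N) ⟩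
    - ((-4M + + N) /ℕ 2N)
      ≡⟨ cong -_ (hermite (-4M + + N) 2N) ⟩
    - ((-4M + + N) /ℕ 4N + (-4M + + N + + 2N) /ℕ 4N)
      ≡⟨ cong₂ (λ x y → - (x /ℕ 4N + y /ℕ 4N)) one-quarter three-quarters ⟩
    - ((+ 1 * + N - M * + 4) /ℕ 4N + (+ 3 * + N - M * + 4) /ℕ 4N)
      ≡⟨ neg-distrib-+ ((+ 1 * + N - M * + 4) /ℕ 4N) ((+ 3 * + N - M * + 4) /ℕ 4N) ⟩
    - ((+ 1 * + N - M * + 4) /ℕ 4N) - (+ 3 * + N - M * + 4) /ℕ 4N ∎
    where
    open ≡-Reasoning
    2N = 2 ℕ.* N
    4N = 2 ℕ.* 2N
    -4M = - (+ 4 * M)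
    -2M = - (+ 2 * M)

    halve : -4M /ℕ 2N ≡ -2M /ℕ N
    halve = trans (cong (_/ℕ 2N) (ring M)) (/ℕ-cancelˡ-* -2M 2 N)
      where
      ring : ∀ M → - (+ 4 * M) ≡ + 2 * - (+ 2 * M)
      ring = solve-∀

    cancel : ∀ a b → - (a + b) + a ≡ - b
    cancel = solve-∀

    one-quarter : -4M + + N ≡ + 1 * + N - M * + 4
    one-quarter = ring M (+ N)
      where
      ring : ∀ M N → - (+ 4 * M) + N ≡ + 1 * N - M * + 4
      ring = solve-∀

    three-quarters : -4M + + N + + 2N ≡ + 3 * + N - M * + 4
    three-quarters = trans (cong (_+_ (-4M + + N)) (pos-* 2 N)) (ring M (+ N))
      where
      ring : ∀ M N → - (+ 4 * M) + N + + 2 * N ≡ + 3 * N - M * + 4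
      ring = solve-∀

module RationalFloor where

  open import Defs using (frac)
  open import Data.Nat as ℕ using (ℕ)
  import Data.Nat.Properties as ℕ
  open import Data.Integer as ℤ using (+_; _*_; _/ℕ_)
  import Data.Integer.Properties as ℤ
  open import Data.Integer.DivMod using (_%ℕ_; a≡a%ℕn+[a/ℕn]*n)
  open import Data.Integer.Tactic.RingSolver using (solve-∀)
  open import Data.Rational as ℚ using (floor; toℚᵘ; _/_; _-_)
  open import Data.Rational.Properties using (toℚᵘ-fromℚᵘ; toℚᵘ-homo-+; toℚᵘ-homo‿-)
  open import Data.Rational.Unnormalised as ℚᵘ using (mkℚᵘ; *≡*; _≃_) renaming (_/_ to _/ᵘ_)
  open import Data.Rational.Unnormalised.Properties as ℚᵘ using (≃-trans; +-congʳ; +-cong; -‿cong)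
  open import Relation.Binary.PropositionalEquality
  open FloorDivision using (/ℕ-cross)

  floor-≃ : ∀ y z d .{{_ : ℕ.NonZero d}} → toℚᵘ y ≃ z /ᵘ d → floor y ≡ z /ℕ d
  floor-≃ (ℚ.mkℚ n e-1 _) z d@(ℕ.suc _) (*≡* eq) =
    trans (ℤ.*-identityˡ (n /ℕ ℕ.suc e-1)) (/ℕ-cross n z (ℕ.suc e-1) d eq)

  toℚᵘ-/ : ∀ z d .{{_ : ℕ.NonZero d}} → toℚᵘ (z / d) ≃ z /ᵘ d
  toℚᵘ-/ z (ℕ.suc d-1) = toℚᵘ-fromℚᵘ (mkℚᵘ z d-1)

  toℚᵘ-- : ∀ x y → toℚᵘ (x - y) ≃ toℚᵘ x ℚᵘ.- toℚᵘ y
  toℚᵘ-- x y = ≃-trans (toℚᵘ-homo-+ x (ℚ.- y)) (+-congʳ (toℚᵘ x) (toℚᵘ-homo‿- y))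

  /ᵘ-≃ : ∀ {a b} d e .{{_ : ℕ.NonZero d}} .{{_ : ℕ.NonZero e}} → a * + e ≡ b * + d → a /ᵘ d ≃ b /ᵘ e
  /ᵘ-≃ (ℕ.suc _) (ℕ.suc _) eq = *≡* eq

  -ᵘ-/ : ∀ a b d e .{{_ : ℕ.NonZero d}} .{{_ : ℕ.NonZero e}} .{{_ : ℕ.NonZero (d ℕ.* e)}} →
         a /ᵘ d ℚᵘ.- b /ᵘ e ≃ (a * + e ℤ.- b * + d) /ᵘ (d ℕ.* e)
  -ᵘ-/ a b d@(ℕ.suc _) e@(ℕ.suc _) =
    ℚᵘ.≃-reflexive (cong (λ x → (a * + e ℤ.+ x) /ᵘ (d ℕ.* e)) (sym (ℤ.neg-distribˡ-* b (+ d))))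

  floor-/ : ∀ z d .{{_ : ℕ.NonZero d}} → floor (z / d) ≡ z /ℕ d
  floor-/ z d = floor-≃ (z / d) z d (toℚᵘ-/ z d)

  remainder : ∀ z d .{{_ : ℕ.NonZero d}} → z ℤ.- (z /ℕ d) * + d ≡ + (z %ℕ d)
  remainder z d = begin
    z ℤ.- q * + d                ≡⟨ cong (λ x → x ℤ.- q * + d) (a≡a%ℕn+[a/ℕn]*n z d) ⟩
    + r ℤ.+ q * + d ℤ.- q * + d  ≡⟨ ring (+ r) (q * + d) ⟩
    + r                          ∎
    where
    open ≡-Reasoning
    q = z /ℕ d
    r = z %ℕ d
    ring : ∀ r x → r ℤ.+ x ℤ.- x ≡ r
    ring = solve-∀

  frac-/ : ∀ z d .{{_ : ℕ.NonZero d}} → toℚᵘ (frac (z / d)) ≃ + (z %ℕ d) /ᵘ d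
  frac-/ z d = begin
    toℚᵘ (frac (z / d))                 ≈⟨ toℚᵘ-- (z / d) (f / 1) ⟩
    toℚᵘ (z / d) ℚᵘ.- toℚᵘ (f / 1)      ≈⟨ +-cong (toℚᵘ-/ z d) (-‿cong (toℚᵘ-/ f 1)) ⟩
    z /ᵘ d ℚᵘ.- f /ᵘ 1                  ≈⟨ -ᵘ-/ z f d 1 ⟩
    (z * + 1 ℤ.- f * + d) /ᵘ (d ℕ.* 1)  ≈⟨ /ᵘ-≃ (d ℕ.* 1) d (cong₂ _*_ numerator denominator) ⟩
    + (z %ℕ d) /ᵘ d                     ∎
    where
    open ℚᵘ.≃-Reasoning
    instance
      d*1≢0 : ℕ.NonZero (d ℕ.* 1)
      d*1≢0 = ℕ.m*n≢0 d 1
    f = floor (z / d)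
    numerator : z * + 1 ℤ.- f * + d ≡ + (z %ℕ d)
    numerator = trans (cong₂ (λ x q → x ℤ.- q * + d) (ℤ.*-identityʳ z) (floor-/ z d)) (remainder z d)
    denominator : + d ≡ + (d ℕ.* 1)
    denominator = cong +_ (sym (ℕ.*-identityʳ d))

  floor-frac- : ∀ z w d e .{{_ : ℕ.NonZero d}} .{{_ : ℕ.NonZero e}} .{{_ : ℕ.NonZero (d ℕ.* e)}} →
                floor (frac (z / d) - w / e) ≡ (+ (z %ℕ d) * + e ℤ.- w * + d) /ℕ (d ℕ.* e)
  floor-frac- z w d e = floor-≃ (frac (z / d) - w / e) _ (d ℕ.* e) (begin
    toℚᵘ (frac (z / d) - w / e)                  ≈⟨ toℚᵘ-- (frac (z / d)) (w / e) ⟩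
    toℚᵘ (frac (z / d)) ℚᵘ.- toℚᵘ (w / e)        ≈⟨ +-cong (frac-/ z d) (-‿cong (toℚᵘ-/ w e)) ⟩
    + (z %ℕ d) /ᵘ d ℚᵘ.- w /ᵘ e                  ≈⟨ -ᵘ-/ (+ (z %ℕ d)) w d e ⟩
    (+ (z %ℕ d) * + e ℤ.- w * + d) /ᵘ (d ℕ.* e)  ∎)
    where open ℚᵘ.≃-Reasoning

module OddResidues where

  open import Data.Nat
  open import Data.Nat.DivMod using (_%_; m%n<n; %-distribˡ-*; m∣n⇒o%n%m≡o%m; m*n%n≡0)
  open import Data.Nat.Divisibility using (_∣_; divides; m%n≡0⇒n∣m; ∣1⇒≡1)
  open import Data.Nat.Primality using (euclidsLemma; prime[2])
  open import Data.Product using (_×_; _,_)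
  open import Data.Sum using (_⊎_; inj₁; inj₂; [_,_])
  open import Data.Empty using (⊥-elim)
  open import Relation.Binary.PropositionalEquality using (_≡_; refl; cong; trans; module ≡-Reasoning)
  open import Relation.Nullary using (¬_)

  odd-^ : ∀ {p} → ¬ 2 ∣ p → ∀ i → ¬ 2 ∣ p ^ i
  odd-^ p-odd zero 2∣1 with ∣1⇒≡1 2∣1
  ... | ()
  odd-^ {p} p-odd (suc i) 2∣p^[i+1] = [ p-odd , odd-^ p-odd i ] (euclidsLemma p (p ^ i) prime[2] 2∣p^[i+1])

  odd-mod-4 : ∀ n → ¬ 2 ∣ n → (n % 4 ≡ 1 × 3 * n % 4 ≡ 3) ⊎ (n % 4 ≡ 3 × 3 * n % 4 ≡ 1)
  odd-mod-4 n n-odd = classify (n % 4) refl (m%n<n n 4)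
    where
    not-even : ∀ {c} → n % 4 ≡ c → ¬ 2 ∣ c
    not-even {c} n%4≡c (divides k c≡k·2) = n-odd (m%n≡0⇒n∣m n 2 (begin
      n % 2      ≡⟨ m∣n⇒o%n%m≡o%m 2 4 n (divides 2 refl) ⟨
      n % 4 % 2  ≡⟨ cong (_% 2) (trans n%4≡c c≡k·2) ⟩
      k * 2 % 2  ≡⟨ m*n%n≡0 k 2 ⟩
      0          ∎))
      where open ≡-Reasoning
    3n-mod-4 : ∀ {c} → n % 4 ≡ c → 3 * n % 4 ≡ 3 * c % 4
    3n-mod-4 n%4≡c = trans (%-distribˡ-* 3 n 4) (cong (λ c → 3 * c % 4) n%4≡c)
    classify : ∀ c → n % 4 ≡ c → c < 4 → (n % 4 ≡ 1 × 3 * n % 4 ≡ 3) ⊎ (n % 4 ≡ 3 × 3 * n % 4 ≡ 1)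
    classify 0 n%4≡0 _ = ⊥-elim (not-even n%4≡0 (divides 0 refl))
    classify 1 n%4≡1 _ = inj₁ (n%4≡1 , 3n-mod-4 n%4≡1)
    classify 2 n%4≡2 _ = ⊥-elim (not-even n%4≡2 (divides 1 refl))
    classify 3 n%4≡3 _ = inj₂ (n%4≡3 , 3n-mod-4 n%4≡3)
    classify (suc (suc (suc (suc _)))) _ (s≤s (s≤s (s≤s (s≤s ()))))

open import Defs
open import Data.Nat using (ℕ; _*_; _^_; _∸_; _<_; _≤_; NonZero)
open import Data.Nat.Primality using (Prime)
open import Data.Integer using (ℤ; +_; -_; _+_; _-_)
open import Data.Rational using (ℚ; floor; _/_) renaming (_-_ to _-ℚ_)
open import Relation.Binary.PropositionalEquality using (_≡_)
open import Relation.Nullary using (¬_)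
open import Data.Nat.Divisibility using (_∣_)

open import Data.Nat.DivMod using (_%_)
import Data.Nat.Properties as ℕ
import Data.Integer as ℤ
import Data.Integer.Properties as ℤ
open import Data.Integer.DivMod using (_/ℕ_)
open import Data.Integer.Tactic.RingSolver using (solve-∀)
open import Data.Product using (_×_; _,_)
open import Data.Sum using (_⊎_; inj₁; inj₂)
open import Relation.Binary.PropositionalEquality using (refl; sym; trans; cong; cong₂; module ≡-Reasoning)
open FloorDivision using (/ℕ-cross; quarter-identity)
open RationalFloor using (floor-/; floor-frac-)
open OddResidues using (odd-^; odd-mod-4)

lemma2p7 : (p r : ℕ) → Prime p → ¬ (2 ∣ p) →
           (a i : ℕ) → a ≤ p ^ r ∸ 2 → i < r → .{{_ : NonZero (p ^ r ∸ 1)}} →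
           (- floor ((- (+ (4 * a * p ^ i))) / (p ^ r ∸ 1))) + floor ((- (+ (2 * a * p ^ i))) / (p ^ r ∸ 1))
             ≡ (- floor (frac ((+ (p ^ i)) / 4) -ℚ ((+ (a * p ^ i)) / (p ^ r ∸ 1))))
               - floor (frac ((+ (3 * p ^ i)) / 4) -ℚ ((+ (a * p ^ i)) / (p ^ r ∸ 1)))
lemma2p7 p r _ p-odd a i _ _ = begin
  - floor (-[k·M] 4 / N) + floor (-[k·M] 2 / N)
    ≡⟨ cong₂ (λ x y → - x + y) (lhs-term 4) (lhs-term 2) ⟩
  - ((- (+ 4 ℤ.* M)) /ℕ N) + (- (+ 2 ℤ.* M)) /ℕ N
    ≡⟨ quarter-identity M N ⟩
  - quarter 1 - quarter 3
    ≡⟨ residues (odd-mod-4 P (odd-^ p-odd i)) ⟩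
  - quarter (P % 4) - quarter (3 * P % 4)
    ≡⟨ cong₂ (λ x y → - x - y) (rhs-term P) (rhs-term (3 * P)) ⟨
  - floor (frac (+ P / 4) -ℚ M / N) - floor (frac (+ (3 * P) / 4) -ℚ M / N) ∎
  where
  open ≡-Reasoning
  N = p ^ r ∸ 1
  P = p ^ i
  M = + (a * P)
  instance
    2N≢0 : NonZero (2 * N)
    2N≢0 = ℕ.m*n≢0 2 N
    2·2N≢0 : NonZero (2 * (2 * N))
    2·2N≢0 = ℕ.m*n≢0 2 (2 * N)
    4N≢0 : NonZero (4 * N)
    4N≢0 = ℕ.m*n≢0 4 N

  -[k·M] : ℕ → ℤ
  -[k·M] k = - (+ (k * a * P))

  -- ⌊c/4 - M/N⌋ as an integer quotient
  numerator : ℕ → ℤ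
  numerator c = + c ℤ.* + N - M ℤ.* + 4

  quarter : ℕ → ℤ
  quarter c = numerator c /ℕ (2 * (2 * N))

  lhs-term : ∀ k → floor (-[k·M] k / N) ≡ (- (+ k ℤ.* M)) /ℕ N
  lhs-term k = trans (floor-/ (-[k·M] k) N) (cong (λ x → (- x) /ℕ N) (trans (cong +_ (ℕ.*-assoc k a P)) (ℤ.pos-* k (a * P))))

  rhs-term : ∀ c → floor (frac (+ c / 4) -ℚ M / N) ≡ quarter (c % 4)
  rhs-term c = trans (floor-frac- (+ c) M 4 N)
    (/ℕ-cross (numerator (c % 4)) (numerator (c % 4)) (4 * N) (2 * (2 * N))
      (cong (λ n → numerator (c % 4) ℤ.* + n) (sym (ℕ.*-assoc 2 2 N))))

  residues : ∀ {c₁ c₃} → (c₁ ≡ 1 × c₃ ≡ 3) ⊎ (c₁ ≡ 3 × c₃ ≡ 1) → - quarter 1 - quarter 3 ≡ - quarter c₁ - quarter c₃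
  residues (inj₁ (refl , refl)) = refl
  residues (inj₂ (refl , refl)) = swap (quarter 1) (quarter 3)
    where
    swap : ∀ x y → - x - y ≡ - y - x
    swap = solve-∀
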